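{- Let $m,n\in\mathbb{N}$ with $m<n$ and let $d\ge0$ be an integer. There is a bijection between $\mathrm{DPF}^\uparrow_{m,n,d}$ and $\{\mathbf{y}\in\mathrm{PF}^\uparrow_{n+d,n+d}: y_{n+d}\le m+1-d\}$.
   Context: For $\mathbf{x}\in[n+1]^m$: cars $1,\ldots,m$ arrive in order at an infinitely long street with spots $1,2,3,\ldots$, car $i$ parking in the first empty spot numbered $\ge x_i$; the defect is the number of cars parking in a spot numbered greater than $n$. $\mathrm{DPF}^\uparrow_{m,n,d}$ is the set of nondecreasing $\mathbf{x}\in[n+1]^m$ with defect $d$. $\mathrm{PF}^\uparrow_{N,N}$ is the set of nondecreasing $\mathbf{y}=(y_1,\ldots,y_N)$ of positive integers with $y_j\le j$ for all $j$. -}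

module Defs where

open import Data.Nat using (ℕ; zero; suc; _+_; _∸_; _≤_; _<_; _<?_; _≟_)
open import Data.Bool using (Bool; true; false; if_then_else_)
open import Data.List using (List; []; _∷_; length; filter; last)
open import Data.Bool.ListAction using (any)
open import Data.List.Relation.Unary.All using (All)
open import Data.List.Relation.Unary.Linked using (Linked)
open import Data.Maybe.Relation.Unary.All as MaybeAll using ()
open import Data.Vec using (Vec; toList)
open import Data.Product using (Σ; _×_)
open import Data.Unit using (⊤)
open import Relation.Binary.PropositionalEquality using (_≡_)
open import Relation.Nullary.Decidable using (⌊_⌋)

occupied : List ℕ → ℕ → Bool
occupied occ a = any (λ b → ⌊ b ≟ a ⌋) occ

-- first spot ≥ a not in occ; the fuel (length occ) always suffices,
-- since at most (length occ) distinct occupied spots can be skipped.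
firstFree : ℕ → List ℕ → ℕ → ℕ
firstFree zero    occ a = a
firstFree (suc f) occ a = if occupied occ a then firstFree f occ (suc a) else a

-- parking process on the infinite street 1,2,3,...; given already occupied
-- spots and the remaining preferences, returns the spots taken by the
-- remaining cars, in arrival order.
parkFrom : List ℕ → List ℕ → List ℕ
parkFrom occ []       = []
parkFrom occ (x ∷ xs) = let s = firstFree (length occ) occ x in s ∷ parkFrom (s ∷ occ) xs

parkingSpots : List ℕ → List ℕ
parkingSpots = parkFrom []

defect : ℕ → List ℕ → ℕ
defect n xs = length (filter (λ s → n <? s) (parkingSpots xs))

DPF↑ : ℕ → ℕ → ℕ → Set
DPF↑ m n d = Σ (Vec ℕ m) λ x →
  All (λ a → 1 ≤ a × a ≤ suc n) (toList x) ×
  Linked _≤_ (toList x) ×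
  defect n (toList x) ≡ d

BoundedByIndexFrom : ℕ → List ℕ → Set
BoundedByIndexFrom j []       = ⊤
BoundedByIndexFrom j (y ∷ ys) = y ≤ j × BoundedByIndexFrom (suc j) ys

IsPF↑ : (N : ℕ) → Vec ℕ N → Set
IsPF↑ N y = All (λ a → 1 ≤ a) (toList y) × Linked _≤_ (toList y) × BoundedByIndexFrom 1 (toList y)

PF↑LastBounded : ℕ → ℕ → Set
PF↑LastBounded N b = Σ (Vec ℕ N) λ y → IsPF↑ N y × MaybeAll.All (λ v → v ≤ b) (last (toList y))

{-# OPTIONS --safe #-}

-- A nondecreasing sequence with values in [1, b] is a lattice word: reading the values in order,
-- ↑ raises the current value by one and ↓ records it, ending at value b.  For a preference
-- x ∈ [n+1]^m the ↑s are the spots 1, …, n and the ↓s are the cars.  Nondecreasing cars park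
-- greedily, so the defect is the number of cars still waiting once spot n has gone by, which is
-- the maximal height d of the reversed complemented word u (m ups, n downs).
-- Cut u = p q where it first reaches height d and rotate it to v = q p̄, with p̄ the reversed
-- complement of p.  Then v has m − d ups, n + d downs and maximal height 0: q never rises above
-- its start, p̄ never rises at all, and m < n leaves q with at least as many downs as ups.  The
-- cut is recovered from v as the first passage of v̄ to height d.  Finally the words of maximal
-- height 0 encode the y ∈ PF↑_{N,N}, the height condition being y_j ≤ j, and the m − d ups
-- bound y_N by m − d + 1.
module Submission where

open import Defs
open import Data.Bool using (true; false; _∨_)
open import Data.Bool.Properties using (∨-zeroʳ)
open import Data.List using (List; []; _∷_; _++_; [_]; length; replicate; filter; last)
open import Data.List.Properties using (++-assoc; ++-identityʳ; filter-accept; filter-reject)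
open import Data.List.Relation.Unary.All as All using (All; []; _∷_)
open import Data.List.Relation.Unary.Linked as Linked using (Linked; []; [-]; _∷_)
open import Data.Maybe.Relation.Unary.All as MaybeAll using (just; nothing)
open import Data.Nat
  using (ℕ; zero; suc; pred; _+_; _∸_; _<_; _≤_; z≤n; s≤s; s≤s⁻¹; _⊔_; _<?_; _≟_; _≤?_)
open import Data.Nat.Properties
open import Data.Product using (Σ; _×_; _,_; proj₁; proj₂; map₁)
open import Data.Product.Properties using (Σ-≡,≡→≡)
open import Data.Sum using (inj₁; inj₂)
open import Data.Vec as Vec using (Vec; toList)
open import Data.Vec.Properties using (length-toList)
open import Function.Base using (_∘_)
open import Function.Bundles using (_↔_; mk↔ₛ′; Inverse)
open import Function.Related.Propositional using (module EquationalReasoning)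
open import Relation.Nullary using (Irrelevant; yes; no; ¬_; contradiction)
open import Relation.Nullary.Decidable using (dec-true; dec-false; isYes≗does)
open import Relation.Binary.PropositionalEquality
  using (_≡_; refl; sym; trans; cong; cong₂; subst; subst₂; module ≡-Reasoning)

×-irrelevant : ∀ {A B : Set} → Irrelevant A → Irrelevant B → Irrelevant (A × B)
×-irrelevant irrA irrB (a , b) (a′ , b′) = cong₂ _,_ (irrA a a′) (irrB b b′)

mk↔-subset : ∀ {A B : Set} {P : A → Set} {Q : B → Set} →
             (∀ a → Irrelevant (P a)) → (∀ b → Irrelevant (Q b)) →
             (f : A → B) (g : (b : B) → Q b → A) →
             (f-pres : ∀ a → P a → Q (f a)) (g-pres : ∀ b (q : Q b) → P (g b q)) →
             (∀ b (q : Q b) → f (g b q) ≡ b) → (∀ a (p : P a) → g (f a) (f-pres a p) ≡ a) →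
             Σ A P ↔ Σ B Q
mk↔-subset P-irr Q-irr f g f-pres g-pres fg gf =
  mk↔ₛ′ (λ (a , p) → f a , f-pres a p) (λ (b , q) → g b q , g-pres b q)
        (λ (b , q) → Σ-≡,≡→≡ (fg b q , Q-irr b _ q))
        (λ (a , p) → Σ-≡,≡→≡ (gf a p , P-irr a _ p))

empty↔empty : ∀ {A B : Set} → ¬ A → ¬ B → A ↔ B
empty↔empty ¬a ¬b =
  mk↔ₛ′ (λ a → contradiction a ¬a) (λ b → contradiction b ¬b)
        (λ b → contradiction b ¬b) (λ a → contradiction a ¬a)

OfLength : ∀ {A : Set} → ℕ → (List A → Set) → List A → Set
OfLength m P l = length l ≡ m × P l

OfLength-irrelevant : ∀ {A : Set} {m} {P : List A → Set} →
                      (∀ l → Irrelevant (P l)) → ∀ l → Irrelevant (OfLength m P l)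
OfLength-irrelevant P-irr l = ×-irrelevant ≡-irrelevant (P-irr l)

fromList≡ : ∀ {A : Set} {m} (l : List A) → length l ≡ m → Vec A m
fromList≡ {m = zero}  []      _ = Vec.[]
fromList≡ {m = suc m} (x ∷ l) e = x Vec.∷ fromList≡ l (suc-injective e)

toList-fromList≡ : ∀ {A : Set} {m} (l : List A) (e : length l ≡ m) → toList (fromList≡ l e) ≡ l
toList-fromList≡ {m = zero}  []      _ = refl
toList-fromList≡ {m = suc m} (x ∷ l) e = cong (x ∷_) (toList-fromList≡ l (suc-injective e))

fromList≡-toList : ∀ {A : Set} {m} (v : Vec A m) (e : length (toList v) ≡ m) → fromList≡ (toList v) e ≡ v
fromList≡-toList Vec.[]      refl = refl
fromList≡-toList (x Vec.∷ v) e    = cong (x Vec.∷_) (fromList≡-toList v (suc-injective e))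

Σ-Vec↔Σ-List : ∀ {A : Set} {m} (P : List A → Set) → (∀ l → Irrelevant (P l)) →
               Σ (Vec A m) (P ∘ toList) ↔ Σ (List A) (OfLength m P)
Σ-Vec↔Σ-List P P-irr = mk↔-subset (P-irr ∘ toList) (OfLength-irrelevant P-irr)
  toList (λ l (e , _) → fromList≡ l e)
  (λ v p → length-toList v , p) (λ l (e , p) → subst P (sym (toList-fromList≡ l e)) p)
  (λ l (e , _) → toList-fromList≡ l e) (λ v _ → fromList≡-toList v _)

pred[m]≤n⇒m≤1+n : ∀ {m k} → pred m ≤ k → m ≤ suc k
pred[m]≤n⇒m≤1+n {zero}  _ = z≤n
pred[m]≤n⇒m≤1+n {suc m} p = s≤s p

[m⊔n]∸m≡n∸m : ∀ m n → (m ⊔ n) ∸ m ≡ n ∸ m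
[m⊔n]∸m≡n∸m m n = trans (∸-distribʳ-⊔ m m n) (cong (_⊔ (n ∸ m)) (n∸n≡0 m))

m≤n≤m⊔o⇒o⊔n≡m⊔o : ∀ {m n o} → m ≤ n → n ≤ m ⊔ o → o ⊔ n ≡ m ⊔ o
m≤n≤m⊔o⇒o⊔n≡m⊔o {m} {n} {o} m≤n n≤m⊔o =
  ≤-antisym (⊔-lub (m≤n⊔m m o) n≤m⊔o) (⊔-lub (≤-trans m≤n (m≤n⊔m o n)) (m≤m⊔n o n))

replicate-++-∷ : ∀ {A : Set} k (x : A) xs → replicate k x ++ x ∷ xs ≡ x ∷ replicate k x ++ xs
replicate-++-∷ zero    x xs = refl
replicate-++-∷ (suc k) x xs = cong (x ∷_) (replicate-++-∷ k x xs)

Linked-lowerHead : ∀ {a b l} → a ≤ b → Linked _≤_ (b ∷ l) → Linked _≤_ (a ∷ l)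
Linked-lowerHead a≤b [-]       = [-]
Linked-lowerHead a≤b (b≤x ∷ l) = ≤-trans a≤b b≤x ∷ l

Linked-∷ : ∀ {a l} → All (a ≤_) l → Linked _≤_ l → Linked _≤_ (a ∷ l)
Linked-∷ []        []     = [-]
Linked-∷ (a≤x ∷ _) sorted = a≤x ∷ sorted

All⇒last : ∀ {A : Set} {P : A → Set} l → All P l → MaybeAll.All P (last l)
All⇒last []          _         = nothing
All⇒last (x ∷ [])    (px ∷ _)  = just px
All⇒last (x ∷ y ∷ l) (_ ∷ pyl) = All⇒last (y ∷ l) pyl

last⇒All : ∀ {b} l → Linked _≤_ l → MaybeAll.All (_≤ b) (last l) → All (_≤ b) l
last⇒All []          _              _          = []
last⇒All (x ∷ [])    _              (just x≤b) = x≤b ∷ []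
last⇒All (x ∷ y ∷ l) (x≤y ∷ sorted) last≤b with last⇒All (y ∷ l) sorted last≤b
... | y≤b ∷ rest = ≤-trans x≤y y≤b ∷ y≤b ∷ rest

-- Lattice words

data Step : Set where
  ↑ ↓ : Step

Word : Set
Word = List Step

flip : Step → Step
flip ↑ = ↓
flip ↓ = ↑

ups : Word → ℕ
ups []      = 0
ups (↑ ∷ w) = suc (ups w)
ups (↓ ∷ w) = ups w

downs : Word → ℕ
downs []      = 0
downs (↑ ∷ w) = downs w
downs (↓ ∷ w) = suc (downs w)

-- The largest value of ups − downs over the prefixes of w (the empty prefix included).
maxHeight : Word → ℕ
maxHeight []      = 0
maxHeight (↑ ∷ w) = suc (maxHeight w)
maxHeight (↓ ∷ w) = pred (maxHeight w)

mirror : Word → Word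
mirror []      = []
mirror (s ∷ w) = mirror w ++ [ flip s ]

ups-++ : ∀ u v → ups (u ++ v) ≡ ups u + ups v
ups-++ []      v = refl
ups-++ (↑ ∷ u) v = cong suc (ups-++ u v)
ups-++ (↓ ∷ u) v = ups-++ u v

downs-++ : ∀ u v → downs (u ++ v) ≡ downs u + downs v
downs-++ []      v = refl
downs-++ (↑ ∷ u) v = downs-++ u v
downs-++ (↓ ∷ u) v = cong suc (downs-++ u v)

ups-mirror : ∀ w → ups (mirror w) ≡ downs w
ups-mirror []      = refl
ups-mirror (↑ ∷ w) = trans (ups-++ (mirror w) [ ↓ ]) (trans (+-identityʳ _) (ups-mirror w))
ups-mirror (↓ ∷ w) = trans (ups-++ (mirror w) [ ↑ ]) (trans (+-comm _ 1) (cong suc (ups-mirror w)))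

downs-mirror : ∀ w → downs (mirror w) ≡ ups w
downs-mirror []      = refl
downs-mirror (↑ ∷ w) = trans (downs-++ (mirror w) [ ↓ ]) (trans (+-comm _ 1) (cong suc (downs-mirror w)))
downs-mirror (↓ ∷ w) = trans (downs-++ (mirror w) [ ↑ ]) (trans (+-identityʳ _) (downs-mirror w))

mirror-++ : ∀ u v → mirror (u ++ v) ≡ mirror v ++ mirror u
mirror-++ []      v = sym (++-identityʳ (mirror v))
mirror-++ (s ∷ u) v = trans (cong (_++ [ flip s ]) (mirror-++ u v)) (++-assoc (mirror v) (mirror u) _)

mirror-involutive : ∀ w → mirror (mirror w) ≡ w
mirror-involutive []      = refl
mirror-involutive (↑ ∷ w) = trans (mirror-++ (mirror w) [ ↓ ]) (cong (↑ ∷_) (mirror-involutive w))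
mirror-involutive (↓ ∷ w) = trans (mirror-++ (mirror w) [ ↑ ]) (cong (↓ ∷_) (mirror-involutive w))

maxHeight-≤-ups : ∀ w → maxHeight w ≤ ups w
maxHeight-≤-ups []      = z≤n
maxHeight-≤-ups (↑ ∷ w) = s≤s (maxHeight-≤-ups w)
maxHeight-≤-ups (↓ ∷ w) = ≤-trans pred[n]≤n (maxHeight-≤-ups w)

ups-≤-maxHeight+downs : ∀ w → ups w ≤ maxHeight w + downs w
ups-≤-maxHeight+downs []      = z≤n
ups-≤-maxHeight+downs (↑ ∷ w) = s≤s (ups-≤-maxHeight+downs w)
ups-≤-maxHeight+downs (↓ ∷ w) = begin
  ups w                               ≤⟨ ups-≤-maxHeight+downs w ⟩
  maxHeight w + downs w               ≤⟨ +-monoˡ-≤ (downs w) (pred[m]≤n⇒m≤1+n ≤-refl) ⟩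
  suc (pred (maxHeight w)) + downs w  ≡⟨ +-suc _ (downs w) ⟨
  pred (maxHeight w) + suc (downs w)  ∎
  where open ≤-Reasoning

maxHeight-prefix : ∀ u v → maxHeight u ≤ maxHeight (u ++ v)
maxHeight-prefix []      v = z≤n
maxHeight-prefix (↑ ∷ u) v = s≤s (maxHeight-prefix u v)
maxHeight-prefix (↓ ∷ u) v = pred-mono-≤ (maxHeight-prefix u v)

maxHeight-++-≤ : ∀ u v k → maxHeight u ≤ k → maxHeight v + ups u ≤ k + downs u → maxHeight (u ++ v) ≤ k
maxHeight-++-≤ []      v k _ hv = subst₂ _≤_ (+-identityʳ _) (+-identityʳ _) hv
maxHeight-++-≤ (↑ ∷ u) v (suc k) (s≤s hu) hv =
  s≤s (maxHeight-++-≤ u v k hu (s≤s⁻¹ (subst (_≤ suc (k + downs u)) (+-suc (maxHeight v) (ups u)) hv)))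
maxHeight-++-≤ (↓ ∷ u) v k hu hv =
  pred-mono-≤ (maxHeight-++-≤ u v (suc k) (pred[m]≤n⇒m≤1+n hu) (subst (maxHeight v + ups u ≤_) (+-suc k (downs u)) hv))

-- The number of cars still waiting after w is read from left to right, starting with q waiting cars:
-- ↓ is an arriving car and ↑ a spot, which takes one waiting car if there is one.
backlog : ℕ → Word → ℕ
backlog q []      = q
backlog q (↑ ∷ w) = backlog (pred q) w
backlog q (↓ ∷ w) = backlog (suc q) w

backlog-++ : ∀ q u v → backlog q (u ++ v) ≡ backlog (backlog q u) v
backlog-++ q []      v = refl
backlog-++ q (↑ ∷ u) v = backlog-++ (pred q) u v
backlog-++ q (↓ ∷ u) v = backlog-++ (suc q) u v

backlog-mirror : ∀ w → backlog 0 (mirror w) ≡ maxHeight w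
backlog-mirror []      = refl
backlog-mirror (↑ ∷ w) = trans (backlog-++ 0 (mirror w) [ ↓ ]) (cong suc (backlog-mirror w))
backlog-mirror (↓ ∷ w) = trans (backlog-++ 0 (mirror w) [ ↑ ]) (cong pred (backlog-mirror w))

-- First passages and rotation

-- p climbs to height d (ups − downs = d) and reaches it for the first time at its end.
data FirstPassage : ℕ → Word → Set where
  []  : FirstPassage 0 []
  ↑∷_ : ∀ {d p} → FirstPassage d p → FirstPassage (suc d) (↑ ∷ p)
  ↓∷_ : ∀ {d p} → FirstPassage (suc (suc d)) p → FirstPassage (suc d) (↓ ∷ p)

firstPassage : ℕ → Word → Word × Word
firstPassage zero    w       = [] , w
firstPassage (suc d) []      = [] , []
firstPassage (suc d) (↑ ∷ w) = map₁ (↑ ∷_) (firstPassage d w)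
firstPassage (suc d) (↓ ∷ w) = map₁ (↓ ∷_) (firstPassage (suc (suc d)) w)

firstPassage-++ : ∀ d w → proj₁ (firstPassage d w) ++ proj₂ (firstPassage d w) ≡ w
firstPassage-++ zero    w       = refl
firstPassage-++ (suc d) []      = refl
firstPassage-++ (suc d) (↑ ∷ w) = cong (↑ ∷_) (firstPassage-++ d w)
firstPassage-++ (suc d) (↓ ∷ w) = cong (↓ ∷_) (firstPassage-++ (suc (suc d)) w)

firstPassage-unique : ∀ {d p} → FirstPassage d p → ∀ q → firstPassage d (p ++ q) ≡ (p , q)
firstPassage-unique []       q = refl
firstPassage-unique (↑∷ fp) q = cong (map₁ (↑ ∷_)) (firstPassage-unique fp q)
firstPassage-unique (↓∷ fp) q = cong (map₁ (↓ ∷_)) (firstPassage-unique fp q)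

firstPassage-sound : ∀ d w → d ≤ maxHeight w → FirstPassage d (proj₁ (firstPassage d w))
firstPassage-sound zero    w       _       = []
firstPassage-sound (suc d) (↑ ∷ w) (s≤s h) = ↑∷ firstPassage-sound d w h
firstPassage-sound (suc d) (↓ ∷ w) h       = ↓∷ firstPassage-sound (suc (suc d)) w (suc≤pred⇒ h)
  where
  suc≤pred⇒ : ∀ {m} → suc d ≤ pred m → suc (suc d) ≤ m
  suc≤pred⇒ {suc m} h = s≤s h

ups-FirstPassage : ∀ {d p} → FirstPassage d p → ups p ≡ d + downs p
ups-FirstPassage []                  = refl
ups-FirstPassage (↑∷ fp)             = cong suc (ups-FirstPassage fp)
ups-FirstPassage {suc d} {↓ ∷ p} (↓∷ fp) = trans (ups-FirstPassage fp) (sym (+-suc (suc d) (downs p)))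

maxHeight-FirstPassage-++ : ∀ {d p} → FirstPassage d p → ∀ q → maxHeight (p ++ q) ≡ d + maxHeight q
maxHeight-FirstPassage-++ []      q = refl
maxHeight-FirstPassage-++ (↑∷ fp) q = cong suc (maxHeight-FirstPassage-++ fp q)
maxHeight-FirstPassage-++ (↓∷ fp) q = cong pred (maxHeight-FirstPassage-++ fp q)

-- A first passage ends above all its earlier heights, so no suffix of it has more downs than ups.
maxHeight-mirror-FirstPassage : ∀ {d p} → FirstPassage d p → maxHeight (mirror p) ≤ 0
maxHeight-mirror-FirstPassage [] = z≤n
maxHeight-mirror-FirstPassage {suc d} {↑ ∷ p} (↑∷ fp) =
  maxHeight-++-≤ (mirror p) [ ↓ ] 0 (maxHeight-mirror-FirstPassage fp) (begin
    ups (mirror p)    ≡⟨ ups-mirror p ⟩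
    downs p           ≤⟨ m≤n+m (downs p) d ⟩
    d + downs p       ≡⟨ ups-FirstPassage fp ⟨
    ups p             ≡⟨ downs-mirror p ⟨
    downs (mirror p)  ∎)
  where open ≤-Reasoning
maxHeight-mirror-FirstPassage {suc d} {↓ ∷ p} (↓∷ fp) =
  maxHeight-++-≤ (mirror p) [ ↑ ] 0 (maxHeight-mirror-FirstPassage fp) (begin
    suc (ups (mirror p))   ≡⟨ cong suc (ups-mirror p) ⟩
    suc (downs p)          ≤⟨ s≤s (m≤n+m (downs p) (suc d)) ⟩
    suc (suc d) + downs p  ≡⟨ ups-FirstPassage fp ⟨
    ups p                  ≡⟨ downs-mirror p ⟨
    downs (mirror p)       ∎)
  where open ≤-Reasoning

rotate : ℕ → Word → Word
rotate d w = let (p , q) = firstPassage d w in q ++ mirror p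

unrotate : ℕ → Word → Word
unrotate d v = let (p , q) = firstPassage d (mirror v) in p ++ mirror q

module _ {d p} (fp : FirstPassage d p) (q : Word) where
  open ≡-Reasoning

  rotate-FirstPassage : rotate d (p ++ q) ≡ q ++ mirror p
  rotate-FirstPassage = cong (λ (p′ , q′) → q′ ++ mirror p′) (firstPassage-unique fp q)

  unrotate-FirstPassage : unrotate d (mirror (p ++ q)) ≡ p ++ mirror q
  unrotate-FirstPassage = cong (λ (p′ , q′) → p′ ++ mirror q′)
    (trans (cong (firstPassage d) (mirror-involutive (p ++ q))) (firstPassage-unique fp q))


  downs-rotated : downs (q ++ mirror p) ≡ downs (p ++ q) + d
  downs-rotated = begin
    downs (q ++ mirror p)       ≡⟨ downs-++ q (mirror p) ⟩
    downs q + downs (mirror p)  ≡⟨ cong (downs q +_) (trans (downs-mirror p) (ups-FirstPassage fp)) ⟩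
    downs q + (d + downs p)     ≡⟨ cong (downs q +_) (+-comm d (downs p)) ⟩
    downs q + (downs p + d)     ≡⟨ +-assoc (downs q) (downs p) d ⟨
    downs q + downs p + d       ≡⟨ cong (_+ d) (trans (+-comm (downs q) (downs p)) (sym (downs-++ p q))) ⟩
    downs (p ++ q) + d          ∎

  ups-rotated : d + ups (q ++ mirror p) ≡ ups (p ++ q)
  ups-rotated = begin
    d + ups (q ++ mirror p)     ≡⟨ cong (d +_) (trans (ups-++ q (mirror p)) (cong (ups q +_) (ups-mirror p))) ⟩
    d + (ups q + downs p)       ≡⟨ cong (d +_) (+-comm (ups q) (downs p)) ⟩
    d + (downs p + ups q)       ≡⟨ +-assoc d (downs p) (ups q) ⟨
    d + downs p + ups q         ≡⟨ cong (_+ ups q) (ups-FirstPassage fp) ⟨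
    ups p + ups q               ≡⟨ ups-++ p q ⟨
    ups (p ++ q)                ∎

  ups-unrotated : ups (p ++ mirror q) ≡ d + downs (p ++ q)
  ups-unrotated = begin
    ups (p ++ mirror q)         ≡⟨ trans (ups-++ p (mirror q)) (cong (ups p +_) (ups-mirror q)) ⟩
    ups p + downs q             ≡⟨ cong (_+ downs q) (ups-FirstPassage fp) ⟩
    d + downs p + downs q       ≡⟨ +-assoc d (downs p) (downs q) ⟩
    d + (downs p + downs q)     ≡⟨ cong (d +_) (downs-++ p q) ⟨
    d + downs (p ++ q)          ∎

  downs-unrotated : d + downs (p ++ mirror q) ≡ ups (p ++ q)
  downs-unrotated = begin
    d + downs (p ++ mirror q)   ≡⟨ cong (d +_) (trans (downs-++ p (mirror q)) (cong (downs p +_) (downs-mirror q))) ⟩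
    d + (downs p + ups q)       ≡⟨ +-assoc d (downs p) (ups q) ⟨
    d + downs p + ups q         ≡⟨ cong (_+ ups q) (ups-FirstPassage fp) ⟨
    ups p + ups q               ≡⟨ ups-++ p q ⟨
    ups (p ++ q)                ∎

unrotate-rotate : ∀ d w → d ≤ maxHeight w → unrotate d (rotate d w) ≡ w
unrotate-rotate d w d≤h = begin
  unrotate d (q ++ mirror p)           ≡⟨ cong (unrotate d) q++mirror-p≡mirror ⟩
  unrotate d (mirror (p ++ mirror q))  ≡⟨ unrotate-FirstPassage (firstPassage-sound d w d≤h) (mirror q) ⟩
  p ++ mirror (mirror q)               ≡⟨ cong (p ++_) (mirror-involutive q) ⟩
  p ++ q                               ≡⟨ firstPassage-++ d w ⟩
  w                                    ∎
  where
  open ≡-Reasoning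
  p = proj₁ (firstPassage d w)
  q = proj₂ (firstPassage d w)
  q++mirror-p≡mirror : q ++ mirror p ≡ mirror (p ++ mirror q)
  q++mirror-p≡mirror = sym (trans (mirror-++ p (mirror q)) (cong (_++ mirror p) (mirror-involutive q)))

rotate-unrotate : ∀ d v → d ≤ maxHeight (mirror v) → rotate d (unrotate d v) ≡ v
rotate-unrotate d v d≤h = begin
  rotate d (p ++ mirror q)  ≡⟨ rotate-FirstPassage (firstPassage-sound d (mirror v) d≤h) (mirror q) ⟩
  mirror q ++ mirror p      ≡⟨ mirror-++ p q ⟨
  mirror (p ++ q)           ≡⟨ cong mirror (firstPassage-++ d (mirror v)) ⟩
  mirror (mirror v)         ≡⟨ mirror-involutive v ⟩
  v                         ∎
  where
  open ≡-Reasoning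
  p = proj₁ (firstPassage d (mirror v))
  q = proj₂ (firstPassage d (mirror v))

IsPath : (u v h : ℕ) → Word → Set
IsPath u v h w = ups w ≡ u × downs w ≡ v × maxHeight w ≡ h

Path : (u v h : ℕ) → Set
Path u v h = Σ Word (IsPath u v h)

IsPath-irrelevant : ∀ {u v h} w → Irrelevant (IsPath u v h w)
IsPath-irrelevant _ = ×-irrelevant ≡-irrelevant (×-irrelevant ≡-irrelevant ≡-irrelevant)

Path-height≤ups : ∀ {m n d} → Path m n d → d ≤ m
Path-height≤ups (w , up , _ , h) = subst₂ _≤_ h up (maxHeight-≤-ups w)

module _ {m n d : ℕ} (d≤m : d ≤ m) (m<n : m < n) where

  rotated-IsPath : ∀ {p} q → FirstPassage d p → IsPath m n d (p ++ q) → IsPath (m ∸ d) (n + d) 0 (q ++ mirror p)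
  rotated-IsPath {p} q fp (u , v , h) =
      trans (sym (m+n∸m≡n d _)) (cong (_∸ d) (trans (ups-rotated fp q) u))
    , trans (downs-rotated fp q) (cong (_+ d) v)
    , n≤0⇒n≡0 (maxHeight-++-≤ q (mirror p) 0 (≤-reflexive maxHeight-q)
                 (+-mono-≤ (maxHeight-mirror-FirstPassage fp) ups≤downs))
    where
    open ≤-Reasoning
    maxHeight-q : maxHeight q ≡ 0
    maxHeight-q = +-cancelˡ-≡ d _ _ (trans (sym (maxHeight-FirstPassage-++ fp q)) (trans h (sym (+-identityʳ d))))
    ups≤downs : ups q ≤ downs q
    ups≤downs = +-cancelˡ-≤ (downs p) _ _ (begin
      downs p + ups q    ≤⟨ +-monoˡ-≤ (ups q) (subst (downs p ≤_) (sym (ups-FirstPassage fp)) (m≤n+m (downs p) d)) ⟩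
      ups p + ups q      ≡⟨ ups-++ p q ⟨
      ups (p ++ q)       ≡⟨ u ⟩
      m                  ≤⟨ <⇒≤ m<n ⟩
      n                  ≡⟨ v ⟨
      downs (p ++ q)     ≡⟨ downs-++ p q ⟩
      downs p + downs q  ∎)

  unrotated-IsPath : ∀ {p} q → FirstPassage d p →
                     IsPath (m ∸ d) (n + d) 0 (mirror (p ++ q)) → IsPath m n d (p ++ mirror q)
  unrotated-IsPath {p} q fp (u , v , h) =
      trans (ups-unrotated fp q) (trans (cong (d +_) (trans (sym (ups-mirror (p ++ q))) u)) (m+[n∸m]≡n d≤m))
    , +-cancelˡ-≡ d _ _ (trans (downs-unrotated fp q) (trans (sym (downs-mirror (p ++ q))) (trans v (+-comm n d))))
    , trans (maxHeight-FirstPassage-++ fp (mirror q)) (trans (cong (d +_) (n≤0⇒n≡0 maxHeight-mirror-q)) (+-identityʳ d))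
    where
    maxHeight-mirror-q : maxHeight (mirror q) ≤ 0
    maxHeight-mirror-q = ≤-trans (maxHeight-prefix (mirror q) (mirror p))
                                 (≤-reflexive (trans (cong maxHeight (sym (mirror-++ p q))) h))

  d≤maxHeight-mirror : ∀ v → IsPath (m ∸ d) (n + d) 0 v → d ≤ maxHeight (mirror v)
  d≤maxHeight-mirror v (u , dn , _) = ≮⇒≥ λ h<d → <⇒≱ (too-few-downs h<d) (ups-≤-maxHeight+downs (mirror v))
    where
    open ≤-Reasoning
    too-few-downs : maxHeight (mirror v) < d → maxHeight (mirror v) + downs (mirror v) < ups (mirror v)
    too-few-downs h<d = begin-strict
      maxHeight (mirror v) + downs (mirror v)  ≡⟨ cong (maxHeight (mirror v) +_) (trans (downs-mirror v) u) ⟩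
      maxHeight (mirror v) + (m ∸ d)           <⟨ +-monoˡ-< (m ∸ d) h<d ⟩
      d + (m ∸ d)                              ≡⟨ m+[n∸m]≡n d≤m ⟩
      m                                        <⟨ m<n ⟩
      n                                        ≤⟨ m≤m+n n d ⟩
      n + d                                    ≡⟨ trans (ups-mirror v) dn ⟨
      ups (mirror v)                           ∎

  rotate-IsPath : ∀ w → IsPath m n d w → IsPath (m ∸ d) (n + d) 0 (rotate d w)
  rotate-IsPath w pw@(_ , _ , h) =
    rotated-IsPath q (firstPassage-sound d w (≤-reflexive (sym h))) (subst (IsPath m n d) (sym (firstPassage-++ d w)) pw)
    where
    q = proj₂ (firstPassage d w)

  unrotate-IsPath : ∀ v → IsPath (m ∸ d) (n + d) 0 v → IsPath m n d (unrotate d v)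
  unrotate-IsPath v pv =
    unrotated-IsPath q (firstPassage-sound d (mirror v) (d≤maxHeight-mirror v pv))
                       (subst (IsPath (m ∸ d) (n + d) 0) v≡ pv)
    where
    p = proj₁ (firstPassage d (mirror v))
    q = proj₂ (firstPassage d (mirror v))
    v≡ : v ≡ mirror (p ++ q)
    v≡ = trans (sym (mirror-involutive v)) (cong mirror (sym (firstPassage-++ d (mirror v))))

  rotate↔ : Path m n d ↔ Path (m ∸ d) (n + d) 0
  rotate↔ = mk↔-subset IsPath-irrelevant IsPath-irrelevant (rotate d) (λ v _ → unrotate d v)
    rotate-IsPath unrotate-IsPath
    (λ v pv → rotate-unrotate d v (d≤maxHeight-mirror v pv))
    (λ w (_ , _ , h) → unrotate-rotate d w (≤-reflexive (sym h)))

-- Words as nondecreasing sequences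

-- ↑ raises the current value (initially c) and ↓ records it; encode climbs on to b after the last entry.
decode : ℕ → Word → List ℕ
decode c []      = []
decode c (↑ ∷ w) = decode (suc c) w
decode c (↓ ∷ w) = c ∷ decode c w

encode : ℕ → ℕ → List ℕ → Word
encode c b []      = replicate (b ∸ c) ↑
encode c b (y ∷ l) = replicate (y ∸ c) ↑ ++ ↓ ∷ encode y b l

length-decode : ∀ c w → length (decode c w) ≡ downs w
length-decode c []      = refl
length-decode c (↑ ∷ w) = length-decode (suc c) w
length-decode c (↓ ∷ w) = cong suc (length-decode c w)

decode-linked : ∀ c w → Linked _≤_ (c ∷ decode c w)
decode-linked c []      = [-]
decode-linked c (↑ ∷ w) = Linked-lowerHead (n≤1+n c) (decode-linked (suc c) w)
decode-linked c (↓ ∷ w) = ≤-refl ∷ decode-linked c w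

decode-bounded : ∀ c w → All (λ a → c ≤ a × a ≤ c + ups w) (decode c w)
decode-bounded c []      = []
decode-bounded c (↑ ∷ w) =
  All.map (λ (lo , hi) → ≤-trans (n≤1+n c) lo , ≤-trans hi (≤-reflexive (sym (+-suc c (ups w)))))
          (decode-bounded (suc c) w)
decode-bounded c (↓ ∷ w) = (≤-refl , m≤m+n c (ups w)) ∷ decode-bounded c w

ups-replicate-++ : ∀ k w → ups (replicate k ↑ ++ w) ≡ k + ups w
ups-replicate-++ zero    w = refl
ups-replicate-++ (suc k) w = cong suc (ups-replicate-++ k w)

downs-replicate-++ : ∀ k w → downs (replicate k ↑ ++ w) ≡ downs w
downs-replicate-++ zero    w = refl
downs-replicate-++ (suc k) w = downs-replicate-++ k w

decode-replicate-++ : ∀ k c w → decode c (replicate k ↑ ++ w) ≡ decode (k + c) w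
decode-replicate-++ zero    c w = refl
decode-replicate-++ (suc k) c w = trans (decode-replicate-++ k (suc c) w) (cong (λ c′ → decode c′ w) (+-suc k c))

downs-encode : ∀ c b l → downs (encode c b l) ≡ length l
downs-encode c b []      = trans (cong downs (sym (++-identityʳ (replicate (b ∸ c) ↑)))) (downs-replicate-++ (b ∸ c) [])
downs-encode c b (y ∷ l) = trans (downs-replicate-++ (y ∸ c) _) (cong suc (downs-encode y b l))

ups-encode : ∀ c b l → Linked _≤_ (c ∷ l) → All (_≤ b) l → c ≤ b → ups (encode c b l) ≡ b ∸ c
ups-encode c b []      _ _ _ =
  trans (cong ups (sym (++-identityʳ (replicate (b ∸ c) ↑)))) (trans (ups-replicate-++ (b ∸ c) []) (+-identityʳ _))
ups-encode c b (y ∷ l) (c≤y ∷ sorted) (y≤b ∷ bounded) _ = begin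
  ups (replicate (y ∸ c) ↑ ++ ↓ ∷ encode y b l)  ≡⟨ ups-replicate-++ (y ∸ c) _ ⟩
  (y ∸ c) + ups (encode y b l)                   ≡⟨ cong ((y ∸ c) +_) (ups-encode y b l sorted bounded y≤b) ⟩
  (y ∸ c) + (b ∸ y)                              ≡⟨ +-comm (y ∸ c) (b ∸ y) ⟩
  (b ∸ y) + (y ∸ c)                              ≡⟨ +-∸-assoc (b ∸ y) c≤y ⟨
  (b ∸ y) + y ∸ c                                ≡⟨ cong (_∸ c) (m∸n+n≡m y≤b) ⟩
  b ∸ c                                          ∎
  where open ≡-Reasoning

decode-encode : ∀ c b l → Linked _≤_ (c ∷ l) → decode c (encode c b l) ≡ l
decode-encode c b []      _ =
  trans (cong (decode c) (sym (++-identityʳ (replicate (b ∸ c) ↑)))) (decode-replicate-++ (b ∸ c) c [])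
decode-encode c b (y ∷ l) (c≤y ∷ sorted) = begin
  decode c (replicate (y ∸ c) ↑ ++ ↓ ∷ encode y b l)  ≡⟨ decode-replicate-++ (y ∸ c) c _ ⟩
  decode (y ∸ c + c) (↓ ∷ encode y b l)               ≡⟨ cong (λ y′ → decode y′ (↓ ∷ encode y b l)) (m∸n+n≡m c≤y) ⟩
  y ∷ decode y (encode y b l)                         ≡⟨ cong (y ∷_) (decode-encode y b l sorted) ⟩
  y ∷ l                                               ∎
  where open ≡-Reasoning

encode-decode-from : ∀ {p c b} w → p ≤ c → c + ups w ≡ b → encode p b (decode c w) ≡ replicate (c ∸ p) ↑ ++ w
encode-decode-from {p} {c} []      p≤c refl =
  trans (cong (λ b → replicate (b ∸ p) ↑) (+-identityʳ c)) (sym (++-identityʳ _))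
encode-decode-from {p} {c} (↑ ∷ w) p≤c e    = begin
  encode p _ (decode (suc c) w)   ≡⟨ encode-decode-from w (m≤n⇒m≤1+n p≤c) (trans (sym (+-suc c (ups w))) e) ⟩
  replicate (suc c ∸ p) ↑ ++ w    ≡⟨ cong (λ k → replicate k ↑ ++ w) (+-∸-assoc 1 p≤c) ⟩
  ↑ ∷ replicate (c ∸ p) ↑ ++ w    ≡⟨ replicate-++-∷ (c ∸ p) ↑ w ⟨
  replicate (c ∸ p) ↑ ++ ↑ ∷ w    ∎
  where open ≡-Reasoning
encode-decode-from {p} {c} (↓ ∷ w) p≤c e =
  cong (λ w′ → replicate (c ∸ p) ↑ ++ ↓ ∷ w′)
       (trans (encode-decode-from w ≤-refl e) (cong (λ k → replicate k ↑ ++ w) (n∸n≡0 c)))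

encode-decode : ∀ c b w → c + ups w ≡ b → encode c b (decode c w) ≡ w
encode-decode c b w e = trans (encode-decode-from w ≤-refl e) (cong (λ k → replicate k ↑ ++ w) (n∸n≡0 c))

decode-boundedByIndex : ∀ w c j → maxHeight w + c ≤ j → BoundedByIndexFrom j (decode c w)
decode-boundedByIndex []      c j _ = _
decode-boundedByIndex (↑ ∷ w) c j h = decode-boundedByIndex w (suc c) j (subst (_≤ j) (sym (+-suc (maxHeight w) c)) h)
decode-boundedByIndex (↓ ∷ w) c j h =
  ≤-trans (m≤n+m c _) h , decode-boundedByIndex w c (suc j) (≤-trans (+-monoˡ-≤ c (pred[m]≤n⇒m≤1+n ≤-refl)) (s≤s h))

-- The ups after the last ↓ leave no trace in decode c w, hence the hypothesis on ups w.
boundedByIndex-decode : ∀ w c j → BoundedByIndexFrom j (decode c w) → ups w + c ≤ downs w + j → maxHeight w + c ≤ j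
boundedByIndex-decode []      c j _ u = u
boundedByIndex-decode (↑ ∷ w) c j b u =
  subst (_≤ j) (+-suc (maxHeight w) c)
        (boundedByIndex-decode w (suc c) j b (subst (_≤ downs w + j) (sym (+-suc (ups w) c)) u))
boundedByIndex-decode (↓ ∷ w) c j (c≤j , b) u
  with maxHeight w | boundedByIndex-decode w c (suc j) b (subst (ups w + c ≤_) (sym (+-suc (downs w) j)) u)
... | zero  | _ = c≤j
... | suc h | s≤s h+c≤j = h+c≤j

BoundedByIndexFrom-irrelevant : ∀ j l → Irrelevant (BoundedByIndexFrom j l)
BoundedByIndexFrom-irrelevant j []      _ _ = refl
BoundedByIndexFrom-irrelevant j (y ∷ l) = ×-irrelevant ≤-irrelevant (BoundedByIndexFrom-irrelevant (suc j) l)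

-- Parking with nondecreasing preferences

parkSorted : ℕ → List ℕ → List ℕ
parkSorted t []       = []
parkSorted t (x ∷ xs) = x ⊔ t ∷ parkSorted (suc (x ⊔ t)) xs

-- fuel is what lets firstFree, run with fuel length occ, cross the taken block [a, t).
record Filled (occ : List ℕ) (a t : ℕ) : Set where
  field
    free : ∀ z → t ≤ z → occupied occ z ≡ false
    full : ∀ z → a ≤ z → z < t → occupied occ z ≡ true
    fuel : t ∸ a ≤ length occ

firstFree-skip : ∀ f {occ x s} → (∀ z → x ≤ z → z < s → occupied occ z ≡ true) → occupied occ s ≡ false →
                 s ∸ x ≤ f → x ≤ s → firstFree f occ x ≡ s
firstFree-skip zero    _ _ gap x≤s = ≤-antisym x≤s (m∸n≡0⇒m≤n (n≤0⇒n≡0 gap))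
firstFree-skip (suc f) {x = x} {s} full free gap x≤s with m≤n⇒m<n∨m≡n x≤s
... | inj₂ refl rewrite free = refl
... | inj₁ x<s  rewrite full x ≤-refl x<s =
  firstFree-skip f (λ z x<z → full z (<⇒≤ x<z)) free (subst (_≤ f) (pred[m∸n]≡m∸[1+n] s x) (pred-mono-≤ gap)) x<s

module _ {occ a t x} (filled : Filled occ a t) (a≤x : a ≤ x) where
  open Filled filled

  full-below-⊔ : ∀ z → x ≤ z → z < x ⊔ t → occupied occ z ≡ true
  full-below-⊔ z x≤z z<x⊔t = full z (≤-trans a≤x x≤z) (≰⇒> λ t≤z → <⇒≱ z<x⊔t (⊔-lub x≤z t≤z))

  gap-below-⊔ : (x ⊔ t) ∸ x ≤ length occ
  gap-below-⊔ = begin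
    (x ⊔ t) ∸ x  ≡⟨ [m⊔n]∸m≡n∸m x t ⟩
    t ∸ x        ≤⟨ ∸-monoʳ-≤ t a≤x ⟩
    t ∸ a        ≤⟨ fuel ⟩
    length occ   ∎
    where open ≤-Reasoning

  firstFree-sorted : firstFree (length occ) occ x ≡ x ⊔ t
  firstFree-sorted = firstFree-skip (length occ) full-below-⊔ (free (x ⊔ t) (m≤n⊔m x t)) gap-below-⊔ (m≤m⊔n x t)

  Filled-park : Filled (x ⊔ t ∷ occ) x (suc (x ⊔ t))
  Filled-park = record { free = free′ ; full = full′ ; fuel = fuel′ }
    where
    free′ : ∀ z → suc (x ⊔ t) ≤ z → occupied (x ⊔ t ∷ occ) z ≡ false
    free′ z s<z = cong₂ _∨_ (trans (isYes≗does (x ⊔ t ≟ z)) (dec-false (x ⊔ t ≟ z) (<⇒≢ s<z)))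
                            (free z (≤-trans (m≤n⊔m x t) (<⇒≤ s<z)))
    full′ : ∀ z → x ≤ z → z < suc (x ⊔ t) → occupied (x ⊔ t ∷ occ) z ≡ true
    full′ z x≤z z≤s with m≤n⇒m<n∨m≡n (s≤s⁻¹ z≤s)
    ... | inj₁ z<s  = trans (cong (_ ∨_) (full-below-⊔ z x≤z z<s)) (∨-zeroʳ _)
    ... | inj₂ refl = cong (_∨ occupied occ z) (trans (isYes≗does (z ≟ z)) (dec-true (z ≟ z) refl))
    fuel′ : suc (x ⊔ t) ∸ x ≤ suc (length occ)
    fuel′ = subst (_≤ suc (length occ)) (sym (+-∸-assoc 1 (m≤m⊔n x t))) (s≤s gap-below-⊔)

parkFrom-sorted : ∀ {occ a t} xs → Filled occ a t → Linked _≤_ (a ∷ xs) → parkFrom occ xs ≡ parkSorted t xs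
parkFrom-sorted []       _      _              = refl
parkFrom-sorted (x ∷ xs) filled (a≤x ∷ sorted) rewrite firstFree-sorted filled a≤x =
  cong (_ ∷_) (parkFrom-sorted xs (Filled-park filled a≤x) sorted)

parkingSpots-sorted : ∀ xs → Linked _≤_ (1 ∷ xs) → parkingSpots xs ≡ parkSorted 1 xs
parkingSpots-sorted xs = parkFrom-sorted xs empty
  where
  empty : Filled [] 1 1
  empty = record { free = λ _ _ → refl ; full = λ _ 1≤z z<1 → contradiction 1≤z (<⇒≱ z<1) ; fuel = z≤n }

spotsAbove : ℕ → List ℕ → ℕ
spotsAbove n l = length (filter (n <?_) l)

spotsAbove-park-step : ∀ n c t l → c ≤ suc n →
                       spotsAbove n (c ⊔ t ∷ l) + (t ⊔ suc n) ≡ spotsAbove n l + (suc (c ⊔ t) ⊔ suc n)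
spotsAbove-park-step n c t l c≤1+n with n <? c ⊔ t
... | yes n<s rewrite filter-accept (n <?_) {xs = l} n<s | m≥n⇒m⊔n≡m (m≤n⇒m≤1+n n<s)
                    | m≤n≤m⊔o⇒o⊔n≡m⊔o c≤1+n n<s
  = sym (+-suc _ (c ⊔ t))
... | no n≮s rewrite filter-reject (n <?_) {xs = l} n≮s | m≤n⇒m⊔n≡n (s≤s (≮⇒≥ n≮s))
                   | m≤n⇒m⊔n≡n (≤-trans (m≤n⊔m c t) (m≤n⇒m≤1+n (≮⇒≥ n≮s)))
  = refl

-- With current value c and first free spot t, the t ∸ c cars parked at spots ≥ c are the backlog;
-- t ⊔ suc n is suc n plus the number of spots beyond n already taken.
spotsAbove-parkSorted : ∀ n w c t → suc n ≡ c + ups w →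
                        spotsAbove n (parkSorted t (decode c w)) + (t ⊔ suc n) ≡ suc n + backlog (t ∸ c) w
spotsAbove-parkSorted n [] c t e = begin
  t ⊔ suc n          ≡⟨ cong (t ⊔_) e′ ⟩
  t ⊔ c              ≡⟨ ⊔-comm t c ⟩
  c ⊔ t              ≡⟨ m+[n∸m]≡n (m≤m⊔n c t) ⟨
  c + (c ⊔ t ∸ c)    ≡⟨ cong₂ _+_ (sym e′) ([m⊔n]∸m≡n∸m c t) ⟩
  suc n + (t ∸ c)    ∎
  where
  open ≡-Reasoning
  e′ : suc n ≡ c
  e′ = trans e (+-identityʳ c)
spotsAbove-parkSorted n (↑ ∷ w) c t e = begin
  spotsAbove n (parkSorted t (decode (suc c) w)) + (t ⊔ suc n)
    ≡⟨ spotsAbove-parkSorted n w (suc c) t (trans e (+-suc c (ups w))) ⟩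
  suc n + backlog (t ∸ suc c) w
    ≡⟨ cong (λ q → suc n + backlog q w) (pred[m∸n]≡m∸[1+n] t c) ⟨
  suc n + backlog (pred (t ∸ c)) w
    ∎
  where open ≡-Reasoning
spotsAbove-parkSorted n (↓ ∷ w) c t e = begin
  spotsAbove n (c ⊔ t ∷ parkSorted (suc (c ⊔ t)) (decode c w)) + (t ⊔ suc n)
    ≡⟨ spotsAbove-park-step n c t _ (subst (c ≤_) (sym e) (m≤m+n c (ups w))) ⟩
  spotsAbove n (parkSorted (suc (c ⊔ t)) (decode c w)) + (suc (c ⊔ t) ⊔ suc n)
    ≡⟨ spotsAbove-parkSorted n w c (suc (c ⊔ t)) e ⟩
  suc n + backlog (suc (c ⊔ t) ∸ c) w
    ≡⟨ cong (λ q → suc n + backlog q w) (trans (+-∸-assoc 1 (m≤m⊔n c t)) (cong suc ([m⊔n]∸m≡n∸m c t))) ⟩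
  suc n + backlog (suc (t ∸ c)) w
    ∎
  where open ≡-Reasoning

defect-decode-mirror : ∀ n u → downs u ≡ n → defect n (decode 1 (mirror u)) ≡ maxHeight u
defect-decode-mirror n u dn = begin
  defect n (decode 1 w)                     ≡⟨ cong (spotsAbove n) (parkingSpots-sorted (decode 1 w) (decode-linked 1 w)) ⟩
  spotsAbove n (parkSorted 1 (decode 1 w))  ≡⟨ +-cancelʳ-≡ (suc n) _ _ (trans counted (+-comm (suc n) _)) ⟩
  backlog 0 w                               ≡⟨ backlog-mirror u ⟩
  maxHeight u                               ∎
  where
  open ≡-Reasoning
  w = mirror u
  counted : spotsAbove n (parkSorted 1 (decode 1 w)) + suc n ≡ suc n + backlog 0 w
  counted = spotsAbove-parkSorted n w 1 1 (cong suc (sym (trans (ups-mirror u) dn)))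

-- The two encodings

IsDPF : ℕ → ℕ → List ℕ → Set
IsDPF n d l = All (λ a → 1 ≤ a × a ≤ suc n) l × Linked _≤_ l × defect n l ≡ d

IsDPF-irrelevant : ∀ {n d} l → Irrelevant (IsDPF n d l)
IsDPF-irrelevant _ = ×-irrelevant (All.irrelevant (×-irrelevant ≤-irrelevant ≤-irrelevant))
                                  (×-irrelevant (Linked.irrelevant ≤-irrelevant) ≡-irrelevant)

IsPFLastBounded : ℕ → List ℕ → Set
IsPFLastBounded b l =
  (All (λ a → 1 ≤ a) l × Linked _≤_ l × BoundedByIndexFrom 1 l) × MaybeAll.All (λ v → v ≤ b) (last l)

IsPFLastBounded-irrelevant : ∀ {b} l → Irrelevant (IsPFLastBounded b l)
IsPFLastBounded-irrelevant l =
  ×-irrelevant (×-irrelevant (All.irrelevant ≤-irrelevant)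
                             (×-irrelevant (Linked.irrelevant ≤-irrelevant) (BoundedByIndexFrom-irrelevant 1 l)))
               (MaybeAll.irrelevant ≤-irrelevant)

dpf↔path : ∀ m n d → Σ (List ℕ) (OfLength m (IsDPF n d)) ↔ Path m n d
dpf↔path m n d = mk↔-subset (OfLength-irrelevant IsDPF-irrelevant) IsPath-irrelevant
  (λ l → mirror (encode 1 (suc n) l)) (λ u _ → decode 1 (mirror u)) to-path from-path
  (λ u (_ , dn , _) → trans (cong mirror (encode-decode 1 (suc n) (mirror u) (cong suc (trans (ups-mirror u) dn))))
                            (mirror-involutive u))
  (λ l (_ , bounded , sorted , _) → trans (cong (decode 1) (mirror-involutive (encode 1 (suc n) l)))
                                          (decode-encode 1 (suc n) l (Linked-∷ (All.map proj₁ bounded) sorted)))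
  where
  to-path : ∀ l → OfLength m (IsDPF n d) l → IsPath m n d (mirror (encode 1 (suc n) l))
  to-path l (len , bounded , sorted , defect≡d) = up , dn , height
    where
    w = encode 1 (suc n) l
    sorted₁ = Linked-∷ (All.map proj₁ bounded) sorted
    up = trans (ups-mirror w) (trans (downs-encode 1 (suc n) l) len)
    dn = trans (downs-mirror w) (ups-encode 1 (suc n) l sorted₁ (All.map proj₂ bounded) (s≤s z≤n))
    height = begin
      maxHeight (mirror w)                    ≡⟨ defect-decode-mirror n (mirror w) dn ⟨
      defect n (decode 1 (mirror (mirror w))) ≡⟨ cong (defect n ∘ decode 1) (mirror-involutive w) ⟩
      defect n (decode 1 w)                   ≡⟨ cong (defect n) (decode-encode 1 (suc n) l sorted₁) ⟩
      defect n l                              ≡⟨ defect≡d ⟩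
      d                                       ∎
      where open ≡-Reasoning
  from-path : ∀ u → IsPath m n d u → OfLength m (IsDPF n d) (decode 1 (mirror u))
  from-path u (up , dn , h) =
      trans (length-decode 1 (mirror u)) (trans (downs-mirror u) up)
    , All.map (λ {a} (lo , hi) → lo , subst (a ≤_) (cong suc (trans (ups-mirror u) dn)) hi) (decode-bounded 1 (mirror u))
    , Linked.tail (decode-linked 1 (mirror u))
    , trans (defect-decode-mirror n u dn) h

pf↔path : ∀ N k → k ≤ N → Σ (List ℕ) (OfLength N (IsPFLastBounded (suc k))) ↔ Path k N 0
pf↔path N k k≤N = mk↔-subset (OfLength-irrelevant IsPFLastBounded-irrelevant) IsPath-irrelevant
  (encode 1 (suc k)) (λ v _ → decode 1 v) to-path from-path
  (λ v (up , _) → encode-decode 1 (suc k) v (cong suc up))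
  (λ l (_ , (pos , sorted , _) , _) → decode-encode 1 (suc k) l (Linked-∷ pos sorted))
  where
  to-path : ∀ l → OfLength N (IsPFLastBounded (suc k)) l → IsPath k N 0 (encode 1 (suc k) l)
  to-path l (len , (pos , sorted , bounded) , last≤) = up , dn , n≤0⇒n≡0 (+-cancelʳ-≤ 1 _ 0 height)
    where
    w = encode 1 (suc k) l
    sorted₁ = Linked-∷ pos sorted
    up = ups-encode 1 (suc k) l sorted₁ (last⇒All l sorted last≤) (s≤s z≤n)
    dn = trans (downs-encode 1 (suc k) l) len
    height = boundedByIndex-decode w 1 1 (subst (BoundedByIndexFrom 1) (sym (decode-encode 1 (suc k) l sorted₁)) bounded)
                                        (+-monoˡ-≤ 1 (subst₂ _≤_ (sym up) (sym dn) k≤N))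
  from-path : ∀ v → IsPath k N 0 v → OfLength N (IsPFLastBounded (suc k)) (decode 1 v)
  from-path v (up , dn , h) =
      trans (length-decode 1 v) dn
    , ( All.map proj₁ (decode-bounded 1 v)
      , Linked.tail (decode-linked 1 v)
      , decode-boundedByIndex v 1 1 (≤-reflexive (cong (_+ 1) h)))
    , All⇒last (decode 1 v) (All.map (λ {a} (_ , hi) → subst (a ≤_) (cong suc up) hi) (decode-bounded 1 v))

PF↑LastBounded-empty : ∀ {N b} → 0 < N → b ≡ 0 → ¬ PF↑LastBounded N b
PF↑LastBounded-empty (s≤s z≤n) refl (x Vec.∷ y , (s≤s z≤n ∷ _ , sorted , _) , last≤0)
  with last⇒All (x ∷ toList y) sorted last≤0
... | () ∷ _

proposition4p20 : (m n d : ℕ) → m < n → DPF↑ m n d ↔ PF↑LastBounded (n + d) (suc m ∸ d)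
proposition4p20 m n d m<n with d ≤? m
... | yes d≤m = begin
  DPF↑ m n d
    ↔⟨ Σ-Vec↔Σ-List (IsDPF n d) IsDPF-irrelevant ⟩
  Σ (List ℕ) (OfLength m (IsDPF n d))
    ↔⟨ dpf↔path m n d ⟩
  Path m n d
    ↔⟨ rotate↔ d≤m m<n ⟩
  Path (m ∸ d) (n + d) 0
    ↔⟨ pf↔path (n + d) (m ∸ d) m∸d≤n+d ⟨
  Σ (List ℕ) (OfLength (n + d) (IsPFLastBounded (suc (m ∸ d))))
    ↔⟨ Σ-Vec↔Σ-List (IsPFLastBounded (suc (m ∸ d))) IsPFLastBounded-irrelevant ⟨
  PF↑LastBounded (n + d) (suc (m ∸ d))
    ≡⟨ cong (PF↑LastBounded (n + d)) (+-∸-assoc 1 d≤m) ⟨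
  PF↑LastBounded (n + d) (suc m ∸ d)
    ∎
  where
  open EquationalReasoning
  m∸d≤n+d : m ∸ d ≤ n + d
  m∸d≤n+d = ≤-trans (m∸n≤m m d) (≤-trans (<⇒≤ m<n) (m≤m+n n d))
... | no d≰m = empty↔empty
  (d≰m ∘ Path-height≤ups ∘ Inverse.to (dpf↔path m n d) ∘ Inverse.to (Σ-Vec↔Σ-List (IsDPF n d) IsDPF-irrelevant))
  (PF↑LastBounded-empty (≤-trans (≤-trans (s≤s z≤n) m<n) (m≤m+n n d)) (m≤n⇒m∸n≡0 (≰⇒> d≰m)))
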